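{- Let $G$ be a $C_4$-free graph with $\alpha(G)\le 2$. Then at least one of the following holds: (i) the complement of $G$ is bipartite; (ii) $G$ can be obtained from the $5$-wheel $W_5$ by clique substitution.
   Context: All graphs are finite and simple. A graph is called $C_4$-free if it does not contain the cycle on four vertices as an induced subgraph. $\alpha(G)$ is the maximum size of an independent set in $G$. The $5$-wheel $W_5$ is the graph obtained from a cycle on five vertices by adding a new vertex adjacent to all five cycle vertices. A clique substitution into a graph $H$ replaces each vertex $v$ of $H$ by a clique $K_v$ (possibly empty, which amounts to deleting $v$), where for distinct vertices $u,v$ of $H$ all edges between $K_u$ and $K_v$ are present if $uv\in E(H)$ and none are present otherwise. -}

module Defs where

open import Data.Nat using (ℕ)
open import Data.Fin using (Fin; zero; suc)
open import Data.Bool using (Bool; true; false)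
open import Data.Product using (_×_; Σ; ∃)
open import Relation.Binary.PropositionalEquality using (_≡_)
open import Relation.Nullary using (¬_)
open import Function.Bundles using (_⇔_)
open import Data.Sum using (_⊎_)

record Graph (n : ℕ) : Set where
  field
    adj   : Fin n → Fin n → Bool
    sym   : ∀ u v → adj u v ≡ adj v u
    irrefl : ∀ u → adj u u ≡ false

open Graph public

Adj : ∀ {n} → Graph n → Fin n → Fin n → Set
Adj G u v = adj G u v ≡ true

NonAdj : ∀ {n} → Graph n → Fin n → Fin n → Set
NonAdj G u v = adj G u v ≡ false

HasInducedC4 : ∀ {n} → Graph n → Set
HasInducedC4 {n} G =
  Σ (Fin n) λ a → Σ (Fin n) λ b → Σ (Fin n) λ c → Σ (Fin n) λ d →
    ¬ a ≡ b × ¬ a ≡ c × ¬ a ≡ d × ¬ b ≡ c × ¬ b ≡ d × ¬ c ≡ d ×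
    Adj G a b × Adj G b c × Adj G c d × Adj G d a ×
    NonAdj G a c × NonAdj G b d

C4Free : ∀ {n} → Graph n → Set
C4Free G = ¬ HasInducedC4 G

IndepAtMost2 : ∀ {n} → Graph n → Set
IndepAtMost2 {n} G = ∀ (u v w : Fin n) →
  ¬ (¬ u ≡ v × ¬ u ≡ w × ¬ v ≡ w ×
     NonAdj G u v × NonAdj G u w × NonAdj G v w)

ComplementBipartite : ∀ {n} → Graph n → Set
ComplementBipartite {n} G = Σ (Fin n → Bool) λ col →
  ∀ u v → ¬ u ≡ v → NonAdj G u v → ¬ col u ≡ col v

-- The 5-wheel W5 on Fin 6: vertices 0..4 form the 5-cycle 0-1-2-3-4-0,
-- vertex 5 is the hub adjacent to all of them.
W5adj : Fin 6 → Fin 6 → Bool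
W5adj zero (suc zero) = true
W5adj (suc zero) zero = true
W5adj (suc zero) (suc (suc zero)) = true
W5adj (suc (suc zero)) (suc zero) = true
W5adj (suc (suc zero)) (suc (suc (suc zero))) = true
W5adj (suc (suc (suc zero))) (suc (suc zero)) = true
W5adj (suc (suc (suc zero))) (suc (suc (suc (suc zero)))) = true
W5adj (suc (suc (suc (suc zero)))) (suc (suc (suc zero))) = true
W5adj (suc (suc (suc (suc zero)))) zero = true
W5adj zero (suc (suc (suc (suc zero)))) = true
W5adj (suc (suc (suc (suc (suc zero))))) (suc (suc (suc (suc (suc zero))))) = false
W5adj (suc (suc (suc (suc (suc zero))))) _ = true
W5adj _ (suc (suc (suc (suc (suc zero))))) = true
W5adj _ _ = false

-- G is obtained from H (on Fin m, adjacency h) by clique substitution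
-- (cliques possibly empty): G is isomorphic to the graph whose vertices
-- are partitioned into cliques K_x (x ∈ V(H)), with K_x, K_y completely
-- joined iff xy ∈ E(H). Equivalently up to isomorphism: a map
-- φ : V(G) → V(H) (φ⁻¹(x) = K_x) such that distinct u, v are adjacent
-- iff φ u = φ v or φ u φ v is an edge of H.
CliqueSubstitutionOf : ∀ {n m} → (Fin m → Fin m → Bool) → Graph n → Set
CliqueSubstitutionOf {n} {m} h G = Σ (Fin n → Fin m) λ φ →
  ∀ u v → ¬ u ≡ v → (Adj G u v ⇔ (φ u ≡ φ v ⊎ h (φ u) (φ v) ≡ true))

module Submission where

-- Let G be C4-free with α(G) ≤ 2.  Everything follows from three local
-- consequences of the hypotheses: two distinct vertices are adjacent if they have a common
-- non-neighbour (α ≤ 2) or two non-adjacent common neighbours (no induced C4), and they are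
-- non-adjacent if they see the two ends of an edge "crosswise" (no induced C4).
--
-- Case 1: G has no induced C5.  Then the complement of G is bipartite: fix a complement
-- edge xy and colour w by whether w is reached from y by a complement walk of length two.
-- A complement edge uv with both ends reached yields an induced C5 (or a complement
-- triangle); one with neither end reached makes u x v y an induced C4.
--
-- Case 2: G has an induced C5, D.  Every vertex v gets a position p in W5 such that v sees
-- D exactly as the vertex p of W5 sees the rim (ignoring D p itself): for a vertex outside
-- D its adjacency profile to D is closed under the two local rules, and a finite check shows
-- that every closed profile is such a row of W5.  A second finite check supplies, for every
-- pair of positions, rim vertices to which the local rules apply, so two vertices are adjacent
-- iff their positions are equal or adjacent in W5; the position map is the clique substitution.
-- The finite facts about W5 are established by evaluating decision procedures.

open import Defs
open import Data.Nat using (ℕ)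
open import Data.Bool using (Bool; true; false)
open import Data.Bool.Properties using (¬-not) renaming (_≟_ to _≟b_)
open import Data.Fin using (Fin; zero; suc; inject₁; #_)
open import Data.Fin.Properties using (_≟_; any?; all?; inject₁-injective)
open import Data.Fin.Subset using (Subset)
open import Data.Fin.Subset.Properties using (anySubset?)
open import Data.Vec using (lookup; tabulate)
open import Data.Vec.Properties using (lookup∘tabulate)
open import Data.Product using (Σ; _×_; _,_; proj₁; proj₂)
open import Data.Sum using (_⊎_; inj₁; inj₂)
import Data.Sum as Sum
open import Data.Empty using (⊥; ⊥-elim)
open import Function using (_∘_)
open import Function.Bundles using (_⇔_; mk⇔)
open import Relation.Binary.PropositionalEquality
  using (_≡_; _≢_; ≢-sym; refl; trans; subst₂) renaming (sym to sym≡)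
open import Relation.Nullary using (¬_; Dec; yes; no; does)
open import Relation.Nullary.Decidable
  using (¬?; _×-dec_; _⊎-dec_; _→-dec_; map′; from-yes; from-no; decidable-stable)

rim : Fin 5 → Fin 6
rim = inject₁

w5 : Fin 6 → Fin 5 → Bool
w5 p j = W5adj p (rim j)

Joined : Fin 6 → Fin 6 → Set
Joined p q = p ≡ q ⊎ W5adj p q ≡ true

Outside : Fin 6 → Fin 5 → Set
Outside p j = rim j ≢ p

Fits : (Fin 5 → Bool) → Fin 6 → Set
Fits f p = ∀ j → Outside p j → f j ≡ w5 p j

-- The two rules satisfied by the profile of a vertex outside an induced C5:
-- it meets every non-adjacent pair of the rim (α ≤ 2), and it sees the middle of
-- every induced path i j k of the rim whose ends it sees (no induced C4).
Closed : (Fin 5 → Bool) → Set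
Closed f =
  (∀ i j → i ≢ j → w5 (rim i) j ≡ false → f i ≡ true ⊎ f j ≡ true) ×
  (∀ i j k → i ≢ k → w5 (rim i) k ≡ false → w5 (rim i) j ≡ true → w5 (rim j) k ≡ true →
     f i ≡ true → f k ≡ true → f j ≡ true)

-- Witnesses forcing adjacency between vertices at positions p and q: a common
-- non-neighbour on the rim, or two non-adjacent common neighbours on the rim.
SharedNonNeighbour : Fin 6 → Fin 6 → Set
SharedNonNeighbour p q = Σ (Fin 5) λ j →
  Outside p j × Outside q j × w5 p j ≡ false × w5 q j ≡ false

SharedNeighbours : Fin 6 → Fin 6 → Set
SharedNeighbours p q = Σ (Fin 5) λ j → Σ (Fin 5) λ k →
  Outside p j × Outside q j × Outside p k × Outside q k × j ≢ k × w5 (rim j) k ≡ false ×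
  w5 p j ≡ true × w5 p k ≡ true × w5 q j ≡ true × w5 q k ≡ true

-- Witness forcing non-adjacency: a rim edge j k with p seeing only k and q seeing only j.
CrossedEdge : Fin 6 → Fin 6 → Set
CrossedEdge p q = Σ (Fin 5) λ j → Σ (Fin 5) λ k →
  Outside p j × Outside q j × Outside p k × Outside q k × w5 (rim j) k ≡ true ×
  w5 p k ≡ true × w5 p j ≡ false × w5 q j ≡ true × w5 q k ≡ false

closed-resp : ∀ {f g : Fin 5 → Bool} → (∀ j → f j ≡ g j) → Closed f → Closed g
closed-resp f≡g (meets , middle) =
  (λ i j i≢j ij → Sum.map (trans (sym≡ (f≡g i))) (trans (sym≡ (f≡g j))) (meets i j i≢j ij)) ,
  (λ i j k i≢k ik ij jk fi fk →
    trans (sym≡ (f≡g j)) (middle i j k i≢k ik ij jk (trans (f≡g i) fi) (trans (f≡g k) fk)))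

outside? : ∀ p j → Dec (Outside p j)
outside? p j = ¬? (rim j ≟ p)

joined? : ∀ p q → Dec (Joined p q)
joined? p q = p ≟ q ⊎-dec W5adj p q ≟b true

fits? : ∀ f p → Dec (Fits f p)
fits? f p = all? λ j → outside? p j →-dec f j ≟b w5 p j

closed? : ∀ f → Dec (Closed f)
closed? f =
  (all? λ i → all? λ j → ¬? (i ≟ j) →-dec w5 (rim i) j ≟b false →-dec
    (f i ≟b true ⊎-dec f j ≟b true)) ×-dec
  (all? λ i → all? λ j → all? λ k → ¬? (i ≟ k) →-dec w5 (rim i) k ≟b false →-dec
    w5 (rim i) j ≟b true →-dec w5 (rim j) k ≟b true →-dec
    f i ≟b true →-dec f k ≟b true →-dec f j ≟b true)

shared-non-neighbour? : ∀ p q → Dec (SharedNonNeighbour p q)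
shared-non-neighbour? p q = any? λ j →
  outside? p j ×-dec outside? q j ×-dec w5 p j ≟b false ×-dec w5 q j ≟b false

shared-neighbours? : ∀ p q → Dec (SharedNeighbours p q)
shared-neighbours? p q = any? λ j → any? λ k →
  outside? p j ×-dec outside? q j ×-dec outside? p k ×-dec outside? q k ×-dec ¬? (j ≟ k) ×-dec
  w5 (rim j) k ≟b false ×-dec w5 p j ≟b true ×-dec w5 p k ≟b true ×-dec
  w5 q j ≟b true ×-dec w5 q k ≟b true

crossed-edge? : ∀ p q → Dec (CrossedEdge p q)
crossed-edge? p q = any? λ j → any? λ k →
  outside? p j ×-dec outside? q j ×-dec outside? p k ×-dec outside? q k ×-dec
  w5 (rim j) k ≟b true ×-dec w5 p k ≟b true ×-dec w5 p j ≟b false ×-dec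
  w5 q j ≟b true ×-dec w5 q k ≟b false

-- The finite facts about W5, proved by running the decision procedures.  They are abstract
-- so that later type checking never unfolds these evaluations.
abstract
  rows-separate : ∀ p j → Outside p j → Σ (Fin 5) λ m → Outside p m × w5 (rim j) m ≢ w5 p m
  rows-separate = from-yes (all? λ p → all? λ j → outside? p j →-dec
    any? λ m → outside? p m ×-dec ¬? (w5 (rim j) m ≟b w5 p m))

  pair-witness : ∀ p q →
    (Joined p q × (SharedNonNeighbour p q ⊎ SharedNeighbours p q)) ⊎ (¬ Joined p q × CrossedEdge p q)
  pair-witness = from-yes (all? λ p → all? λ q →
    (joined? p q ×-dec (shared-non-neighbour? p q ⊎-dec shared-neighbours? p q)) ⊎-dec
    (¬? (joined? p q) ×-dec crossed-edge? p q))

  closed-subset-fits : ∀ (s : Subset 5) → Closed (lookup s) → Σ (Fin 6) (Fits (lookup s))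
  closed-subset-fits s = decidable-stable (fits-some? s)
    (λ fails → from-no (anySubset? (¬? ∘ fits-some?)) (s , fails))
    where
    fits-some? : ∀ (s : Subset 5) → Dec (Closed (lookup s) → Σ (Fin 6) (Fits (lookup s)))
    fits-some? s = closed? (lookup s) →-dec any? (fits? (lookup s))

closed-profile-fits : ∀ f → Closed f → Σ (Fin 6) (Fits f)
closed-profile-fits f closed =
  let (p , fits) = closed-subset-fits (tabulate f) (closed-resp (sym≡ ∘ lookup∘tabulate f) closed)
  in p , λ j j≢p → trans (sym≡ (lookup∘tabulate f j)) (fits j j≢p)

module _ {n : ℕ} (G : Graph n) where

  flip-adj : ∀ {u v b} → adj G u v ≡ b → adj G v u ≡ b
  flip-adj {u} {v} e = trans (sym G v u) e

  separated : ∀ {u x w} → Adj G u w → NonAdj G x w → u ≢ x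
  separated a na refl with trans (sym≡ a) na
  ... | ()

  adj⇒distinct : ∀ {u v} → Adj G u v → u ≢ v
  adj⇒distinct {u} a refl = separated a (irrefl G u) refl

  adj-by-contradiction : ∀ {u v} → ¬ NonAdj G u v → Adj G u v
  adj-by-contradiction = ¬-not

  nonadj-by-contradiction : ∀ {u v} → ¬ Adj G u v → NonAdj G u v
  nonadj-by-contradiction = ¬-not

  adj-iff : ∀ {u v} {J : Set} → J → Adj G u v → Adj G u v ⇔ J
  adj-iff j uv = mk⇔ (λ _ → j) (λ _ → uv)

  nonadj-iff : ∀ {u v} {J : Set} → ¬ J → NonAdj G u v → Adj G u v ⇔ J
  nonadj-iff ¬j uv = mk⇔ (λ adjacent → ⊥-elim (separated adjacent uv refl)) (⊥-elim ∘ ¬j)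

  -- A 4-cycle a b c d with both diagonals missing is an induced C4; only the diagonal
  -- distinctions are not implied by the adjacencies.
  induced-C4 : ∀ {a b c d} → a ≢ c → b ≢ d →
    Adj G a b → Adj G b c → Adj G c d → Adj G d a → NonAdj G a c → NonAdj G b d →
    HasInducedC4 G
  induced-C4 {a} {b} {c} {d} a≢c b≢d ab bc cd da ac bd =
    a , b , c , d , adj⇒distinct ab , a≢c , ≢-sym (adj⇒distinct da) ,
    adj⇒distinct bc , b≢d , adj⇒distinct cd , ab , bc , cd , da , ac , bd

module _ {n : ℕ} (G : Graph n) where

  NonEdge : Fin n → Fin n → Set
  NonEdge u v = u ≢ v × NonAdj G u v

  nonEdge-sym : ∀ {u v} → NonEdge u v → NonEdge v u
  nonEdge-sym (u≢v , uv) = ≢-sym u≢v , flip-adj G uv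

  nonEdge? : ∀ u v → Dec (NonEdge u v)
  nonEdge? u v = ¬? (u ≟ v) ×-dec adj G u v ≟b false

  IsInducedC5 : (Fin 5 → Fin n) → Set
  IsInducedC5 D = ∀ i j → adj G (D i) (D j) ≡ w5 (rim i) j

  InducedC5 : Set
  InducedC5 = Σ (Fin 5 → Fin n) IsInducedC5

  cycleOf : Fin n → Fin n → Fin n → Fin n → Fin n → Fin 5 → Fin n
  cycleOf a b c d e zero = a
  cycleOf a b c d e (suc zero) = b
  cycleOf a b c d e (suc (suc zero)) = c
  cycleOf a b c d e (suc (suc (suc zero))) = d
  cycleOf a b c d e (suc (suc (suc (suc zero)))) = e

  cycleOf-η : ∀ (D : Fin 5 → Fin n) i → cycleOf (D (# 0)) (D (# 1)) (D (# 2)) (D (# 3)) (D (# 4)) i ≡ D i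
  cycleOf-η D zero = refl
  cycleOf-η D (suc zero) = refl
  cycleOf-η D (suc (suc zero)) = refl
  cycleOf-η D (suc (suc (suc zero))) = refl
  cycleOf-η D (suc (suc (suc (suc zero)))) = refl

  induced-C5 : ∀ {a b c d e} →
    Adj G a b → Adj G b c → Adj G c d → Adj G d e → Adj G e a →
    NonAdj G a c → NonAdj G a d → NonAdj G b d → NonAdj G b e → NonAdj G c e →
    IsInducedC5 (cycleOf a b c d e)
  induced-C5 {a} {b} {c} {d} {e} ab bc cd de ea ac ad bd be ce = cyc
    where
    cyc : IsInducedC5 (cycleOf a b c d e)
    cyc zero zero = irrefl G a
    cyc zero (suc zero) = ab
    cyc zero (suc (suc zero)) = ac
    cyc zero (suc (suc (suc zero))) = ad
    cyc zero (suc (suc (suc (suc zero)))) = flip-adj G ea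
    cyc (suc zero) zero = flip-adj G ab
    cyc (suc zero) (suc zero) = irrefl G b
    cyc (suc zero) (suc (suc zero)) = bc
    cyc (suc zero) (suc (suc (suc zero))) = bd
    cyc (suc zero) (suc (suc (suc (suc zero)))) = be
    cyc (suc (suc zero)) zero = flip-adj G ac
    cyc (suc (suc zero)) (suc zero) = flip-adj G bc
    cyc (suc (suc zero)) (suc (suc zero)) = irrefl G c
    cyc (suc (suc zero)) (suc (suc (suc zero))) = cd
    cyc (suc (suc zero)) (suc (suc (suc (suc zero)))) = ce
    cyc (suc (suc (suc zero))) zero = flip-adj G ad
    cyc (suc (suc (suc zero))) (suc zero) = flip-adj G bd
    cyc (suc (suc (suc zero))) (suc (suc zero)) = flip-adj G cd
    cyc (suc (suc (suc zero))) (suc (suc (suc zero))) = irrefl G d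
    cyc (suc (suc (suc zero))) (suc (suc (suc (suc zero)))) = de
    cyc (suc (suc (suc (suc zero)))) zero = ea
    cyc (suc (suc (suc (suc zero)))) (suc zero) = flip-adj G be
    cyc (suc (suc (suc (suc zero)))) (suc (suc zero)) = flip-adj G ce
    cyc (suc (suc (suc (suc zero)))) (suc (suc (suc zero))) = flip-adj G de
    cyc (suc (suc (suc (suc zero)))) (suc (suc (suc (suc zero)))) = irrefl G e

  inducedC5? : Dec InducedC5
  inducedC5? = map′
    (λ (a , b , c , d , e , cyc) → cycleOf a b c d e , cyc)
    (λ (D , cyc) → D (# 0) , D (# 1) , D (# 2) , D (# 3) , D (# 4) , λ i j →
      subst₂ (λ x y → adj G x y ≡ w5 (rim i) j) (sym≡ (cycleOf-η D i)) (sym≡ (cycleOf-η D j)) (cyc i j))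
    (any? λ a → any? λ b → any? λ c → any? λ d → any? λ e → all? λ i → all? λ j →
      adj G (cycleOf a b c d e i) (cycleOf a b c d e j) ≟b w5 (rim i) j)

module _ {n : ℕ} (G : Graph n) where

  common-neighbours⇒adj : C4Free G → ∀ {u v a b} → u ≢ v → a ≢ b →
    Adj G u a → Adj G v a → Adj G u b → Adj G v b → NonAdj G a b → Adj G u v
  common-neighbours⇒adj c4 u≢v a≢b ua va ub vb ab = adj-by-contradiction G λ uv →
    c4 (induced-C4 G u≢v a≢b ua (flip-adj G va) vb (flip-adj G ub) uv ab)

  crossed-edge⇒nonadj : C4Free G → ∀ {u v a b} → u ≢ a → v ≢ b →
    Adj G a b → Adj G u b → NonAdj G u a → Adj G v a → NonAdj G v b → NonAdj G u v
  crossed-edge⇒nonadj c4 u≢a v≢b ab ub ua va vb = nonadj-by-contradiction G λ uv →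
    c4 (induced-C4 G u≢a v≢b uv va ab (flip-adj G ub) ua vb)

  common-non-neighbour⇒adj : IndepAtMost2 G → ∀ {u v w} → u ≢ v → u ≢ w → v ≢ w →
    NonAdj G u w → NonAdj G v w → Adj G u v
  common-non-neighbour⇒adj ind u≢v u≢w v≢w uw vw = adj-by-contradiction G λ uv →
    ind _ _ _ (u≢v , u≢w , v≢w , uv , uw , vw)

module ComplementColouring {n : ℕ} (G : Graph n) (c4 : C4Free G) (ind : IndepAtMost2 G) where

  complement-path⇒adj : ∀ {p r q} → NonEdge G p r → NonEdge G r q → p ≢ q → Adj G p q
  complement-path⇒adj (p≢r , pr) (r≢q , rq) p≢q =
    common-non-neighbour⇒adj G ind p≢q p≢r (≢-sym r≢q) pr (flip-adj G rq)

  no-complement-triangle : ∀ {a b c} → NonEdge G a b → NonEdge G b c → NonEdge G a c → ⊥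
  no-complement-triangle ab bc (a≢c , ac) with trans (sym≡ (complement-path⇒adj ab bc a≢c)) ac
  ... | ()

  TwoStepsFrom : Fin n → Fin n → Set
  TwoStepsFrom y w = Σ (Fin n) λ b → NonEdge G y b × NonEdge G b w

  twoStepsFrom? : ∀ y w → Dec (TwoStepsFrom y w)
  twoStepsFrom? y w = any? λ b → nonEdge? G y b ×-dec nonEdge? G b w

  -- A complement edge with both ends reached from y closes an induced C5 u b' b v y
  -- (b, b' being the middle vertices of the two walks).
  both-reached⇒C5 : ∀ {y u v} → NonEdge G u v → TwoStepsFrom y u → TwoStepsFrom y v → InducedC5 G
  both-reached⇒C5 {y} {u} {v} uv (b , yb , bu) (b' , yb' , b'v) with b ≟ b'
  ... | yes refl = ⊥-elim (no-complement-triangle uv (nonEdge-sym G b'v) (nonEdge-sym G bu))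
  ... | no b≢b' = cycleOf G u b' b v y , induced-C5 G
      (complement-path⇒adj uv (nonEdge-sym G b'v) u≢b')
      (complement-path⇒adj (nonEdge-sym G yb') yb (≢-sym b≢b'))
      (complement-path⇒adj bu uv b≢v)
      (complement-path⇒adj (nonEdge-sym G b'v) (nonEdge-sym G yb') v≢y)
      (complement-path⇒adj yb bu y≢u)
      (proj₂ (nonEdge-sym G bu)) (proj₂ uv) (proj₂ b'v) (proj₂ (nonEdge-sym G yb')) (proj₂ (nonEdge-sym G yb))
    where
    u≢b' : u ≢ b'
    u≢b' refl = no-complement-triangle yb bu yb'
    b≢v : b ≢ v
    b≢v refl = no-complement-triangle yb (nonEdge-sym G b'v) yb'
    v≢y : v ≢ y
    v≢y refl = no-complement-triangle (nonEdge-sym G bu) (nonEdge-sym G yb) uv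
    y≢u : y ≢ u
    y≢u refl = no-complement-triangle uv (nonEdge-sym G b'v) yb'

  -- A complement edge u v with neither end reached from y, where x y is a complement edge:
  -- then u x v y is an induced C4 of G.
  neither-reached⇒C4 : ∀ {x y u v} → NonEdge G x y → NonEdge G u v →
    ¬ TwoStepsFrom y u → ¬ TwoStepsFrom y v → HasInducedC4 G
  neither-reached⇒C4 {x} {y} {u} {v} xy uv u-far v-far =
    induced-C4 G (proj₁ uv) (proj₁ xy) (sees-x u≢x u-far) (flip-adj G (sees-x v≢x v-far))
      (sees-y v≢y uv u-far) (flip-adj G (sees-y u≢y (nonEdge-sym G uv) v-far)) (proj₂ uv) (proj₂ xy)
    where
    y-reached : TwoStepsFrom y y
    y-reached = x , nonEdge-sym G xy , xy
    u≢x : u ≢ x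
    u≢x refl = v-far (x , nonEdge-sym G xy , uv)
    v≢x : v ≢ x
    v≢x refl = u-far (x , nonEdge-sym G xy , nonEdge-sym G uv)
    u≢y : u ≢ y
    u≢y refl = u-far y-reached
    v≢y : v ≢ y
    v≢y refl = v-far y-reached
    -- An unreached w ≢ x is adjacent to x, since otherwise y x w is a complement walk; and
    -- w ≢ y is adjacent to y when a complement neighbour w' of w is unreached (else y w w').
    sees-x : ∀ {w} → w ≢ x → ¬ TwoStepsFrom y w → Adj G w x
    sees-x w≢x far = adj-by-contradiction G λ wx → far (x , nonEdge-sym G xy , ≢-sym w≢x , flip-adj G wx)
    sees-y : ∀ {w w'} → w ≢ y → NonEdge G w' w → ¬ TwoStepsFrom y w' → Adj G w y
    sees-y {w} w≢y w'w far = adj-by-contradiction G λ wy → far (w , (≢-sym w≢y , flip-adj G wy) , nonEdge-sym G w'w)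

  -- Colour w by whether it is reached from y, for a fixed complement edge x y (any colouring
  -- works if there is none).
  complement-bipartite : ¬ InducedC5 G → ComplementBipartite G
  complement-bipartite no-C5 with any? (λ x → any? λ y → nonEdge? G x y)
  ... | no no-nonEdge = (λ _ → true) , λ u v u≢v uv _ → no-nonEdge (u , v , u≢v , uv)
  ... | yes (x , y , xy) = (λ w → does (twoStepsFrom? y w)) ,
          λ u v u≢v uv → proper (u≢v , uv) (twoStepsFrom? y u) (twoStepsFrom? y v)
    where
    proper : ∀ {u v} → NonEdge G u v → (du : Dec (TwoStepsFrom y u)) (dv : Dec (TwoStepsFrom y v)) →
      does du ≢ does dv
    proper uv (yes reached-u) (yes reached-v) _ = no-C5 (both-reached⇒C5 uv reached-u reached-v)
    proper uv (no far-u) (no far-v) _ = c4 (neither-reached⇒C4 xy uv far-u far-v)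
    proper uv (yes _) (no _) ()
    proper uv (no _) (yes _) ()

module W5Positions {n : ℕ} (G : Graph n) (c4 : C4Free G) (ind : IndepAtMost2 G)
                   (D : Fin 5 → Fin n) (cyc : IsInducedC5 G D) where

  profile : Fin n → Fin 5 → Bool
  profile v j = adj G v (D j)

  At : Fin n → Fin 6 → Set
  At v p = Fits (profile v) p

  rim-at : ∀ i → At (D i) (rim i)
  rim-at i j _ = cyc i j

  at-distinct : ∀ {v p j} → At v p → Outside p j → v ≢ D j
  at-distinct {p = p} {j} at j≢p refl =
    let (m , m≢p , rows-differ) = rows-separate p j j≢p
    in rows-differ (trans (sym≡ (cyc j m)) (at m m≢p))

  D-injective : ∀ {j k} → j ≢ k → D j ≢ D k
  D-injective j≢k = at-distinct (rim-at _) (λ k≡j → j≢k (sym≡ (inject₁-injective k≡j)))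

  profile-closed : ∀ {v} → (∀ j → v ≢ D j) → Closed (profile v)
  profile-closed {v} fresh = meets , middle
    where
    meets : ∀ i j → i ≢ j → w5 (rim i) j ≡ false → profile v i ≡ true ⊎ profile v j ≡ true
    meets i j i≢j ij with adj G v (D i) in vi
    ... | true = inj₁ refl
    ... | false = inj₂ (common-non-neighbour⇒adj G ind (fresh j) (fresh i) (D-injective (≢-sym i≢j))
                         vi (flip-adj G (trans (cyc i j) ij)))
    middle : ∀ i j k → i ≢ k → w5 (rim i) k ≡ false → w5 (rim i) j ≡ true → w5 (rim j) k ≡ true →
      profile v i ≡ true → profile v k ≡ true → profile v j ≡ true
    middle i j k i≢k ik ij jk vi vk = common-neighbours⇒adj G c4 (fresh j) (D-injective i≢k)
      vi (flip-adj G (trans (cyc i j) ij)) vk (trans (cyc j k) jk) (trans (cyc i k) ik)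

  position : ∀ v → Σ (Fin 6) (At v)
  position v with any? (λ j → v ≟ D j)
  ... | yes (j , refl) = rim j , rim-at j
  ... | no off-cycle = closed-profile-fits (profile v) (profile-closed λ j v≡Dj → off-cycle (j , v≡Dj))

  position-adjacency : ∀ {u v p q} → u ≢ v → At u p → At v q → Adj G u v ⇔ Joined p q
  position-adjacency {u} {v} {p} {q} u≢v at-u at-v with pair-witness p q
  ... | inj₁ (joined , inj₁ (j , jp , jq , pj , qj)) =
    adj-iff G joined (common-non-neighbour⇒adj G ind u≢v (at-distinct at-u jp) (at-distinct at-v jq)
      (trans (at-u j jp) pj) (trans (at-v j jq) qj))
  ... | inj₁ (joined , inj₂ (j , k , jp , jq , kp , kq , j≢k , jk , pj , pk , qj , qk)) =
    adj-iff G joined (common-neighbours⇒adj G c4 u≢v (D-injective j≢k)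
      (trans (at-u j jp) pj) (trans (at-v j jq) qj) (trans (at-u k kp) pk) (trans (at-v k kq) qk)
      (trans (cyc j k) jk))
  ... | inj₂ (apart , j , k , jp , jq , kp , kq , jk , pk , pj , qj , qk) =
    nonadj-iff G apart (crossed-edge⇒nonadj G c4 (at-distinct at-u jp) (at-distinct at-v kq)
      (trans (cyc j k) jk) (trans (at-u k kp) pk) (trans (at-u j jp) pj)
      (trans (at-v j jq) qj) (trans (at-v k kq) qk))

lemma6 : ∀ (n : ℕ) (G : Graph n) → C4Free G → IndepAtMost2 G →
    ComplementBipartite G ⊎ CliqueSubstitutionOf W5adj G
lemma6 n G c4 ind with inducedC5? G
... | no no-C5 = inj₁ (ComplementColouring.complement-bipartite G c4 ind no-C5)
... | yes (D , cyc) = inj₂ (proj₁ ∘ position , λ u v u≢v →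
        position-adjacency u≢v (proj₂ (position u)) (proj₂ (position v)))
  where open W5Positions G c4 ind D cyc
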